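{- If $n\ge5$, then the complete graph $K_n$ is $2$-canceling.
   Context: A signing of a graph $G$ is a map $\sigma:E(G)\to\{\pm1\}$; for a path $P$, $\sigma(P)=\sum_{e\in P}\sigma(e)$. In a graph $H$, $d_\sigma(u,v)=\min_P|\sigma(P)|$ over all $uv$-paths $P$ in $H$ ($\infty$ if none, $0$ if $u=v$), and $W_\sigma(H)=\frac12\sum_{u,v\in V(H)}d_\sigma(u,v)$. A graph $G$ is $k$-canceling if there is a signing $\sigma$ such that $W_\sigma(G-S)=0$ for every $S\subseteq V(G)$ with $|S|<k$ (with $\sigma$ restricted to $G-S$ and distances computed in $G-S$). -}

module Defs where

open import Data.Bool using (Bool; true; false; not; _∧_; if_then_else_)
open import Data.Nat using (ℕ; zero; suc; _+_; _<_; _⊓_; _/_)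
open import Data.Integer using (ℤ; _◃_)
import Data.Integer as ℤ
open import Data.Sign using (Sign)
open import Data.Fin using (Fin; _≟_)
open import Data.Fin.Subset using (Subset; ∣_∣)
open import Data.Fin.Subset.Properties using (_∈?_)
open import Relation.Nullary using (yes; no)
open import Data.Empty using (⊥-elim)
open import Relation.Binary.PropositionalEquality using (refl; sym)
open import Data.List using (List; []; _∷_; map; concatMap; allFin; upTo; filter; foldr; concat)
open import Data.Bool.ListAction using (all; any)
open import Data.Maybe using (Maybe; just; nothing)
open import Data.Product using (Σ; _×_; _,_)
open import Relation.Nullary.Decidable using (⌊_⌋)
open import Relation.Binary.PropositionalEquality using (_≡_)

record Graph (n : ℕ) : Set where
  field
    adj       : Fin n → Fin n → Bool
    adj-sym   : ∀ u v → adj u v ≡ adj v u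
    adj-irref : ∀ u → adj u u ≡ false
open Graph public

_==_ : ∀ {n} → Fin n → Fin n → Bool
u == v = ⌊ u ≟ v ⌋

K : (n : ℕ) → Graph n
K n = record
  { adj = λ u v → not (u == v)
  ; adj-sym = sym-lemma
  ; adj-irref = irr
  }
  where
  sym-lemma : ∀ (u v : Fin n) → not (u == v) ≡ not (v == u)
  sym-lemma u v with u ≟ v | v ≟ u
  ... | yes _ | yes _ = refl
  ... | no _  | no _  = refl
  ... | yes p | no q = ⊥-elim (q (sym p))
  ... | no p  | yes q = ⊥-elim (p (sym q))
  irr : ∀ (u : Fin n) → not (u == u) ≡ false
  irr u with u ≟ u
  ... | yes _ = refl
  ... | no ¬p = ⊥-elim (¬p refl)

-- A signing σ : E(G) → {±1}.  Represented as a symmetric function on pairs of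
-- vertices; only its values on edges (adj u v ≡ true) are ever used.
record Signing {n : ℕ} (G : Graph n) : Set where
  field
    sgn     : Fin n → Fin n → Sign
    sgn-sym : ∀ u v → sgn u v ≡ sgn v u
open Signing public

listsOfLength : ∀ {n} → ℕ → List (List (Fin n))
listsOfLength zero    = [] ∷ []
listsOfLength (suc k) = concatMap (λ v → map (v ∷_) (listsOfLength k)) (allFin _)

-- all nonempty vertex lists of length ≤ n (every path in a graph on n vertices is among them)
candidates : (n : ℕ) → List (List (Fin n))
candidates n = concatMap (λ k → listsOfLength (suc k)) (upTo n)

nodup : ∀ {n} → List (Fin n) → Bool
nodup []       = true
nodup (x ∷ xs) = not (any (x ==_) xs) ∧ nodup xs

walkEdges : ∀ {n} → Graph n → List (Fin n) → Bool
walkEdges G []           = true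
walkEdges G (x ∷ [])     = true
walkEdges G (x ∷ y ∷ xs) = adj G x y ∧ walkEdges G (y ∷ xs)

headIs : ∀ {n} → Fin n → List (Fin n) → Bool
headIs u []      = false
headIs u (x ∷ _) = u == x

lastIs : ∀ {n} → Fin n → List (Fin n) → Bool
lastIs v []           = false
lastIs v (x ∷ [])     = v == x
lastIs v (x ∷ y ∷ xs) = lastIs v (y ∷ xs)

alive : ∀ {n} → Subset n → Fin n → Bool
alive S x = not ⌊ x ∈? S ⌋

isPath : ∀ {n} → Graph n → Subset n → Fin n → Fin n → List (Fin n) → Bool
isPath G S u v P =
  headIs u P ∧ lastIs v P ∧ nodup P ∧ walkEdges G P ∧ all (alive S) P

sigSum : ∀ {n} {G : Graph n} → Signing G → List (Fin n) → ℤ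
sigSum σ []           = ℤ.0ℤ
sigSum σ (x ∷ [])     = ℤ.0ℤ
sigSum σ (x ∷ y ∷ xs) = (sgn σ x y ◃ 1) ℤ.+ sigSum σ (y ∷ xs)

-- extended naturals: nothing = ∞
ℕ∞ : Set
ℕ∞ = Maybe ℕ

min∞ : ℕ∞ → ℕ∞ → ℕ∞
min∞ nothing  b        = b
min∞ (just a) nothing  = just a
min∞ (just a) (just b) = just (a ⊓ b)

_+∞_ : ℕ∞ → ℕ∞ → ℕ∞
just a +∞ just b = just (a + b)
_      +∞ _      = nothing

-- d_σ(u,v) in G - S: min over uv-paths P in G - S of |σ(P)|, ∞ if none
-- (for u = v the one-vertex path gives 0).
dist : ∀ {n} (G : Graph n) → Signing G → Subset n → Fin n → Fin n → ℕ∞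
dist {n} G σ S u v =
  foldr (λ P acc → min∞ (just (ℤ.∣ sigSum σ P ∣)) acc) nothing
        (filter (λ P → isPath G S u v P Data.Bool.≟ true) (candidates n))
  where import Data.Bool

half∞ : ℕ∞ → ℕ∞
half∞ nothing  = nothing
half∞ (just a) = just (a / 2)

wiener : ∀ {n} (G : Graph n) → Signing G → Subset n → ℕ∞
wiener {n} G σ S =
  half∞ (foldr _+∞_ (just 0)
    (concatMap (λ u → map (λ v → dist G σ S u v)
                          (filter (λ v → alive S v Data.Bool.≟ true) (allFin n)))
               (filter (λ u → alive S u Data.Bool.≟ true) (allFin n))))
  where import Data.Bool

Canceling : ∀ {n} → Graph n → ℕ → Set
Canceling {n} G k =
  Σ (Signing G) λ σ → (S : Subset n) → ∣ S ∣ < k → wiener G σ S ≡ just 0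

-- Sign the edges of a 5-cycle in K₅ negatively and every other edge of Kₙ
-- positively.  Any two vertices of Kₙ, also after deleting one third vertex,
-- are joined by a path with as many negative as positive edges, hence are at
-- signed distance 0: two pentagon vertices by a path of length 2 through the
-- pentagon, of which there are always two with distinct midpoints; a pentagon
-- vertex and an outside vertex through either of the two cycle-neighbours of
-- the former; two outside vertices through one of the five arcs of length 2
-- of the cycle, at least one of which avoids the deleted vertex.
module Submission where

open import Defs
open import Data.Bool using (Bool; true; false; not; _∧_; _∨_; if_then_else_)
import Data.Bool.ListAction
import Data.Bool as Bool
open import Data.Bool.Properties using (∨-comm; ¬-not)
open import Data.Fin using (Fin; zero; suc; _≟_; _↑ˡ_; _↑ʳ_; splitAt)
open import Data.Fin.Properties
  using (all?; any?; ↑ˡ-injective; ↑ʳ-injective; splitAt-↑ˡ; splitAt-↑ʳ)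
open import Data.Fin.Subset using (Subset; ∣_∣; _∈_; ⁅_⁆)
open import Data.Fin.Subset.Properties
  using (_∈?_; p⊂q⇒∣p∣<∣q∣; ∣⁅x⁆∣≡1; x∈⁅y⁆⇒x≡y; x≢y⇒x∉⁅y⁆)
open import Data.Integer using (0ℤ; _◃_)
import Data.Integer as ℤ
open import Data.List using (List; []; _∷_; _++_; length; map; foldr; filter; allFin)
open import Data.List.Membership.Propositional using () renaming (_∈_ to _∈ₗ_)
open import Data.List.Membership.Propositional.Properties
  using (∈-filter⁺; ∈-concatMap⁺; ∈-map⁺; ∈-upTo⁺; ∈-allFin)
open import Data.List.Relation.Unary.All using (All; []; _∷_)
import Data.List.Relation.Unary.All as All
import Data.List.Relation.Unary.All.Properties as All
open import Data.List.Relation.Unary.AllPairs using (AllPairs; []; _∷_; allPairs?)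
import Data.List.Relation.Unary.AllPairs as AllPairs
import Data.List.Relation.Unary.AllPairs.Properties as AllPairs
open import Data.List.Relation.Unary.Any using (here; there)
import Data.List.Relation.Unary.Any as Any
open import Data.Maybe using (just; nothing)
open import Data.Nat using (ℕ; zero; suc; _+_; _≤_; _<_; z≤n; s≤s)
open import Data.Nat.Properties using (⊓-zeroʳ; <⇒≱; m≤n⇒∃[o]m+o≡n)
open import Data.Product using (∃; _×_; _,_)
open import Data.Sign using (Sign)
import Data.Sign as Sign
open import Data.Sum using (_⊎_; inj₁; inj₂)
open import Function using (_∘_)
open import Function.Definitions using (Injective)
open import Relation.Binary.PropositionalEquality
  using (_≡_; _≢_; refl; sym; trans; cong; cong₂; subst)
open import Relation.Nullary using (¬?; yes; no; contradiction)
open import Relation.Nullary.Decidable using (toWitness; _×-dec_; _→-dec_)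

module _ {n : ℕ} {S : Subset n} where

  x∈S∧y∈S∧x≢y⇒2≤∣S∣ : ∀ {x y} → x ∈ S → y ∈ S → x ≢ y → 2 ≤ ∣ S ∣
  x∈S∧y∈S∧x≢y⇒2≤∣S∣ {x} {y} x∈S y∈S x≢y =
    subst (_< ∣ S ∣) (∣⁅x⁆∣≡1 x) (p⊂q⇒∣p∣<∣q∣ (⁅x⁆⊆S , y , y∈S , x≢y⇒x∉⁅y⁆ (x≢y ∘ sym)))
    where
    ⁅x⁆⊆S : ∀ {z} → z ∈ ⁅ x ⁆ → z ∈ S
    ⁅x⁆⊆S z∈⁅x⁆ = subst (_∈ S) (sym (x∈⁅y⁆⇒x≡y x z∈⁅x⁆)) x∈S

  dead⇒∈ : ∀ {x} → alive S x ≡ false → x ∈ S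
  dead⇒∈ {x} dead with x ∈? S
  ... | yes x∈S = x∈S
  dead⇒∈ () | no _

  dead-unique : ∣ S ∣ < 2 → ∀ {x y} → alive S x ≡ false → x ≢ y → alive S y ≡ true
  dead-unique ∣S∣<2 {y = y} x-dead x≢y with alive S y in y-alive
  ... | true  = refl
  ... | false = contradiction (x∈S∧y∈S∧x≢y⇒2≤∣S∣ (dead⇒∈ x-dead) (dead⇒∈ y-alive) x≢y) (<⇒≱ ∣S∣<2)

  all-alive-choice : ∀ {k} {A : Set} {Q : A → Set} → ∣ S ∣ < 2 →
    (f : Fin (suc k) → Fin n) → Injective _≡_ _≡_ f → (route : A → List (Fin (suc k))) →
    (∀ d → ∃ λ a → Q a × All (d ≢_) (route a)) →
    ∃ λ a → Q a × All (λ w → alive S (f w) ≡ true) (route a)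
  all-alive-choice ∣S∣<2 f f-injective route avoiding
    with any? (λ d → alive S (f d) Bool.≟ false)
  ... | yes (d , d-dead) with avoiding d
  ...   | a , qa , avoids-d =
          a , qa , All.map (λ d≢w → dead-unique ∣S∣<2 d-dead (d≢w ∘ f-injective)) avoids-d
  all-alive-choice ∣S∣<2 f f-injective route avoiding | no none with avoiding zero
  ...   | a , qa , _ = a , qa , All.universal (λ w → ¬-not (λ w-dead → none (w , w-dead))) (route a)

record BalancedPath {n} (G : Graph n) (σ : Signing G) (S : Subset n) (u v : Fin n) : Set where
  constructor balancedPath
  field
    path      : List (Fin n)
    candidate : path ∈ₗ candidates n
    is-path   : isPath G S u v path ≡ true
    balanced  : sigSum σ path ≡ 0ℤ

min∞-zero : ∀ {A : Set} (f : A → ℕ) {x : A} {xs : List A} → x ∈ₗ xs → f x ≡ 0 →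
  foldr (λ y acc → min∞ (just (f y)) acc) nothing xs ≡ just 0
min∞-zero f {xs = _ ∷ xs} (here refl) fx≡0
  rewrite fx≡0 with foldr (λ y acc → min∞ (just (f y)) acc) nothing xs
... | nothing = refl
... | just _  = refl
min∞-zero f {xs = y ∷ _} (there x∈xs) fx≡0
  rewrite min∞-zero f x∈xs fx≡0 = cong just (⊓-zeroʳ (f y))

dist≡0 : ∀ {n} {G : Graph n} {σ : Signing G} {S : Subset n} {u v : Fin n} →
  BalancedPath G σ S u v → dist G σ S u v ≡ just 0
dist≡0 (balancedPath P P∈candidates P-is-path P-balanced) =
  min∞-zero _ (∈-filter⁺ _ P∈candidates P-is-path) (cong ℤ.∣_∣ P-balanced)

sum∞-zero : ∀ {xs} → All (_≡ just 0) xs → foldr _+∞_ (just 0) xs ≡ just 0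
sum∞-zero []         = refl
sum∞-zero (refl ∷ p) rewrite sum∞-zero p = refl

wiener≡0 : ∀ {n} (G : Graph n) (σ : Signing G) (S : Subset n) →
  (∀ u v → alive S u ≡ true → alive S v ≡ true → dist G σ S u v ≡ just 0) →
  wiener G σ S ≡ just 0
wiener≡0 {n} G σ S dist-zero = cong half∞ (sum∞-zero (All.concat⁺ (All.map⁺
  (All.map (λ u-alive → All.map⁺ (All.map (dist-zero _ _ u-alive) alive-vertices))
           alive-vertices))))
  where
  alive-vertices : All (λ x → alive S x ≡ true) (filter (λ x → alive S x Bool.≟ true) (allFin n))
  alive-vertices = All.all-filter _ (allFin n)

∈-listsOfLength : ∀ {n} (P : List (Fin n)) → P ∈ₗ listsOfLength (length P)
∈-listsOfLength []      = here refl
∈-listsOfLength (x ∷ P) =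
  ∈-concatMap⁺ _ (Any.map (λ { refl → ∈-map⁺ (x ∷_) (∈-listsOfLength P) }) (∈-allFin x))

∈-candidates : ∀ {n} (x : Fin n) (P : List (Fin n)) → length P < n → (x ∷ P) ∈ₗ candidates n
∈-candidates x P ∣P∣<n =
  ∈-concatMap⁺ _ (Any.map (λ { refl → ∈-listsOfLength (x ∷ P) }) (∈-upTo⁺ ∣P∣<n))

==-refl : ∀ {n} (u : Fin n) → (u == u) ≡ true
==-refl u with u ≟ u
... | yes _   = refl
... | no u≢u = contradiction refl u≢u

≢⇒==-false : ∀ {n} {u v : Fin n} → u ≢ v → (u == v) ≡ false
≢⇒==-false {u = u} {v} u≢v with u ≟ v
... | yes u≡v = contradiction u≡v u≢v
... | no _    = refl

any-==-false : ∀ {n} {x : Fin n} {xs} → All (x ≢_) xs → Data.Bool.ListAction.any (x ==_) xs ≡ false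
any-==-false []                          = refl
any-==-false {x = x} {y ∷ _} (x≢y ∷ x∉xs) = cong₂ _∨_ (≢⇒==-false x≢y) (any-==-false x∉xs)

AllPairs⇒nodup : ∀ {n} {xs : List (Fin n)} → AllPairs _≢_ xs → nodup xs ≡ true
AllPairs⇒nodup []              = refl
AllPairs⇒nodup (x∉xs ∷ xs-distinct) rewrite any-==-false x∉xs = AllPairs⇒nodup xs-distinct

AllPairs⇒walkEdgesᴷ : ∀ {n} {xs : List (Fin n)} → AllPairs _≢_ xs → walkEdges (K n) xs ≡ true
AllPairs⇒walkEdgesᴷ {xs = []}    _ = refl
AllPairs⇒walkEdgesᴷ {xs = _ ∷ []} _ = refl
AllPairs⇒walkEdgesᴷ {xs = x ∷ y ∷ _} ((x≢y ∷ _) ∷ distinct)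
  = cong₂ _∧_ (cong not (≢⇒==-false x≢y)) (AllPairs⇒walkEdgesᴷ distinct)

All⇒all : ∀ {A : Set} {p : A → Bool} {xs} → All (λ x → p x ≡ true) xs →
  Data.Bool.ListAction.all p xs ≡ true
All⇒all []           = refl
All⇒all (px ∷ pxs) rewrite px = All⇒all pxs

lastIs-∷ʳ : ∀ {n} (u : Fin n) ws v → lastIs v (u ∷ ws ++ v ∷ []) ≡ true
lastIs-∷ʳ u []       v = ==-refl v
lastIs-∷ʳ u (w ∷ ws) v = lastIs-∷ʳ w ws v

balancedPathᴷ : ∀ {n} (σ : Signing (K n)) (S : Subset n) (u v : Fin n) (ws : List (Fin n)) →
  length (u ∷ ws ++ v ∷ []) ≤ n → AllPairs _≢_ (u ∷ ws ++ v ∷ []) →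
  All (λ x → alive S x ≡ true) (u ∷ ws ++ v ∷ []) → sigSum σ (u ∷ ws ++ v ∷ []) ≡ 0ℤ →
  BalancedPath (K n) σ S u v
balancedPathᴷ {n} σ S u v ws ∣P∣≤n distinct all-alive P-balanced =
  balancedPath _ (∈-candidates u (ws ++ v ∷ []) ∣P∣≤n) P-is-path P-balanced
  where
  P-is-path : isPath (K n) S u v (u ∷ ws ++ v ∷ []) ≡ true
  P-is-path rewrite ==-refl u | lastIs-∷ʳ u ws v | AllPairs⇒nodup distinct
                  | AllPairs⇒walkEdgesᴷ distinct | All⇒all all-alive = refl

trivialBalancedPath : ∀ {n} (G : Graph n) (σ : Signing G) (S : Subset n) {u : Fin n} →
  alive S u ≡ true → BalancedPath G σ S u u
trivialBalancedPath {suc _} G σ S {u} u-alive =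
  balancedPath (u ∷ []) (∈-candidates u [] (s≤s z≤n)) u-is-path refl
  where
  u-is-path : isPath G S u u (u ∷ []) ≡ true
  u-is-path rewrite ==-refl u | u-alive = refl

module _ {k : ℕ} (m : ℕ) (σ : Signing (K k)) where

  extendedSign : Fin k ⊎ Fin m → Fin k ⊎ Fin m → Sign
  extendedSign (inj₁ i) (inj₁ j) = sgn σ i j
  extendedSign _        _        = Sign.+

  extendedSign-sym : ∀ x y → extendedSign x y ≡ extendedSign y x
  extendedSign-sym (inj₁ i) (inj₁ j) = sgn-sym σ i j
  extendedSign-sym (inj₁ _) (inj₂ _) = refl
  extendedSign-sym (inj₂ _) (inj₁ _) = refl
  extendedSign-sym (inj₂ _) (inj₂ _) = refl

  positiveExtension : Signing (K (k + m))
  positiveExtension = record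
    { sgn     = λ x y → extendedSign (splitAt k x) (splitAt k y)
    ; sgn-sym = λ x y → extendedSign-sym (splitAt k x) (splitAt k y)
    }

  sgn-↑ˡ : ∀ i j → sgn positiveExtension (i ↑ˡ m) (j ↑ˡ m) ≡ sgn σ i j
  sgn-↑ˡ i j rewrite splitAt-↑ˡ k i m | splitAt-↑ˡ k j m = refl

  sgn-↑ˡ-↑ʳ : ∀ i j → sgn positiveExtension (i ↑ˡ m) (k ↑ʳ j) ≡ Sign.+
  sgn-↑ˡ-↑ʳ i j rewrite splitAt-↑ˡ k i m | splitAt-↑ʳ k m j = refl

  sgn-↑ʳ-↑ˡ : ∀ j i → sgn positiveExtension (k ↑ʳ j) (i ↑ˡ m) ≡ Sign.+
  sgn-↑ʳ-↑ˡ j i rewrite splitAt-↑ˡ k i m | splitAt-↑ʳ k m j = refl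

  sigSum-map-↑ˡ : ∀ xs → sigSum positiveExtension (map (_↑ˡ m) xs) ≡ sigSum σ xs
  sigSum-map-↑ˡ []           = refl
  sigSum-map-↑ˡ (_ ∷ [])     = refl
  sigSum-map-↑ˡ (i ∷ j ∷ xs) = cong₂ ℤ._+_ (cong (_◃ 1) (sgn-↑ˡ i j)) (sigSum-map-↑ˡ (j ∷ xs))

module _ {k m : ℕ} where

  ↑ˡ≢↑ʳ : ∀ (i : Fin k) (j : Fin m) → i ↑ˡ m ≢ k ↑ʳ j
  ↑ˡ≢↑ʳ i j eq with trans (sym (splitAt-↑ˡ k i m)) (trans (cong (splitAt k) eq) (splitAt-↑ʳ k m j))
  ... | ()

  AllPairs-map-↑ˡ : ∀ {xs : List (Fin k)} → AllPairs _≢_ xs → AllPairs _≢_ (map (_↑ˡ m) xs)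
  AllPairs-map-↑ˡ = AllPairs.map⁺ ∘ AllPairs.map (λ i≢j → i≢j ∘ ↑ˡ-injective m _ _)

  AllPairs-map-↑ˡ-∷ʳ : ∀ {xs : List (Fin k)} (j : Fin m) → AllPairs _≢_ xs →
    AllPairs _≢_ (map (_↑ˡ m) xs ++ (k ↑ʳ j) ∷ [])
  AllPairs-map-↑ˡ-∷ʳ {xs} j distinct = AllPairs.++⁺ (AllPairs-map-↑ˡ distinct) ([] ∷ [])
    (All.map⁺ (All.universal (λ i → ↑ˡ≢↑ʳ i j ∷ []) xs))

  ↑ʳ∉map-↑ˡ : ∀ (j : Fin m) (xs : List (Fin k)) → All (k ↑ʳ j ≢_) (map (_↑ˡ m) xs)
  ↑ʳ∉map-↑ˡ j xs = All.map⁺ (All.universal (λ i → ↑ˡ≢↑ʳ i j ∘ sym) xs)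

  data Side : Fin (k + m) → Set where
    left  : (i : Fin k) → Side (i ↑ˡ m)
    right : (j : Fin m) → Side (k ↑ʳ j)

side : ∀ {k m} (x : Fin (k + m)) → Side {k} {m} x
side {zero}  x       = right x
side {suc k} zero    = left zero
side {suc k} (suc x) with side {k} x
... | left i  = left (suc i)
... | right j = right j

next : Fin 5 → Fin 5
next zero                         = suc zero
next (suc zero)                   = suc (suc zero)
next (suc (suc zero))             = suc (suc (suc zero))
next (suc (suc (suc zero)))       = suc (suc (suc (suc zero)))
next (suc (suc (suc (suc zero)))) = zero

pentagonSign : Fin 5 → Fin 5 → Sign
pentagonSign i j = if (j == next i) ∨ (i == next j) then Sign.- else Sign.+

pentagon : Signing (K 5)
pentagon = record
  { sgn     = pentagonSign
  ; sgn-sym = λ i j → cong (if_then Sign.- else Sign.+) (∨-comm (j == next i) (i == next j))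
  }

pentagonSign-next : ∀ i → pentagonSign i (next i) ≡ Sign.-
pentagonSign-next i rewrite ==-refl (next i) = refl

arc : Fin 5 → List (Fin 5)
arc a = a ∷ next a ∷ next (next a) ∷ []

-- These facts are checked by evaluating decision procedures, made opaque so that
-- they are not re-evaluated where used.  In each, the quantifier over d asks for
-- routes through two different interiors, one of which survives any deletion.

opaque
  pentagon-detours : ∀ i j → i ≢ j → ∀ d → ∃ λ w →
    (AllPairs _≢_ (i ∷ w ∷ j ∷ []) × sigSum pentagon (i ∷ w ∷ j ∷ []) ≡ 0ℤ) × All (d ≢_) (w ∷ [])
  pentagon-detours = toWitness {a? = all? λ i → all? λ j → ¬? (i ≟ j) →-dec all? λ d → any? λ w →
    (allPairs? (λ x y → ¬? (x ≟ y)) (i ∷ w ∷ j ∷ []) ×-dec sigSum pentagon (i ∷ w ∷ j ∷ []) ℤ.≟ 0ℤ)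
    ×-dec All.all? (λ x → ¬? (d ≟ x)) (w ∷ [])} _

  pentagon-negativeNeighbours : ∀ i d → ∃ λ w →
    (i ≢ w × pentagonSign i w ≡ Sign.-) × All (d ≢_) (w ∷ [])
  pentagon-negativeNeighbours = toWitness {a? = all? λ i → all? λ d → any? λ w →
    (¬? (i ≟ w) ×-dec pentagonSign i w Sign.≟ Sign.-) ×-dec All.all? (λ x → ¬? (d ≟ x)) (w ∷ [])} _

  pentagon-arcs : ∀ d → ∃ λ a → AllPairs _≢_ (arc a) × All (d ≢_) (arc a)
  pentagon-arcs = toWitness {a? = all? λ d → any? λ a →
    allPairs? (λ x y → ¬? (x ≟ y)) (arc a) ×-dec All.all? (λ x → ¬? (d ≟ x)) (arc a)} _

extendedPentagon : ∀ m → Signing (K (5 + m))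
extendedPentagon m = positiveExtension m pentagon

module _ (m : ℕ) {S : Subset (5 + m)} (∣S∣<2 : ∣ S ∣ < 2) where

  private
    core : Fin 5 → Fin (5 + m)
    core = _↑ˡ m

    outer : Fin m → Fin (5 + m)
    outer = 5 ↑ʳ_

    σ : Signing (K (5 + m))
    σ = extendedPentagon m

  balancedPath-core-core : ∀ {i j} → i ≢ j → alive S (core i) ≡ true → alive S (core j) ≡ true →
    BalancedPath (K (5 + m)) σ S (core i) (core j)
  balancedPath-core-core {i} {j} i≢j i-alive j-alive
    with all-alive-choice ∣S∣<2 core (↑ˡ-injective m _ _) (_∷ []) (pentagon-detours i j i≢j)
  ... | w , (distinct , balanced) , w-alive ∷ [] =
    balancedPathᴷ σ S _ _ (core w ∷ []) (s≤s (s≤s (s≤s z≤n))) (AllPairs-map-↑ˡ distinct)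
      (i-alive ∷ w-alive ∷ j-alive ∷ []) (trans (sigSum-map-↑ˡ m pentagon (i ∷ w ∷ j ∷ [])) balanced)

  balancedPath-core-outer : ∀ {i j} → alive S (core i) ≡ true → alive S (outer j) ≡ true →
    BalancedPath (K (5 + m)) σ S (core i) (outer j)
  balancedPath-core-outer {i} {j} i-alive j-alive
    with all-alive-choice ∣S∣<2 core (↑ˡ-injective m _ _) (_∷ []) (pentagon-negativeNeighbours i)
  ... | w , (i≢w , negative) , w-alive ∷ [] =
    balancedPathᴷ σ S _ _ (core w ∷ []) (s≤s (s≤s (s≤s z≤n)))
      (AllPairs-map-↑ˡ-∷ʳ j ((i≢w ∷ []) ∷ [] ∷ [])) (i-alive ∷ w-alive ∷ j-alive ∷ []) balanced
    where
    balanced : sigSum σ (core i ∷ core w ∷ outer j ∷ []) ≡ 0ℤ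
    balanced rewrite sgn-↑ˡ m pentagon i w | negative | sgn-↑ˡ-↑ʳ m pentagon w j = refl

  balancedPath-outer-core : ∀ {j i} → alive S (outer j) ≡ true → alive S (core i) ≡ true →
    BalancedPath (K (5 + m)) σ S (outer j) (core i)
  balancedPath-outer-core {j} {i} j-alive i-alive
    with all-alive-choice ∣S∣<2 core (↑ˡ-injective m _ _) (_∷ []) (pentagon-negativeNeighbours i)
  ... | w , (i≢w , negative) , w-alive ∷ [] =
    balancedPathᴷ σ S _ _ (core w ∷ []) (s≤s (s≤s (s≤s z≤n)))
      (↑ʳ∉map-↑ˡ j (w ∷ i ∷ []) ∷ AllPairs-map-↑ˡ (((i≢w ∘ sym) ∷ []) ∷ [] ∷ []))
      (j-alive ∷ w-alive ∷ i-alive ∷ []) balanced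
    where
    balanced : sigSum σ (outer j ∷ core w ∷ core i ∷ []) ≡ 0ℤ
    balanced rewrite sgn-↑ʳ-↑ˡ m pentagon j w | sgn-↑ˡ m pentagon w i
                   | sgn-sym pentagon w i | negative = refl

  balancedPath-outer-outer : ∀ {j j′} → j ≢ j′ → alive S (outer j) ≡ true → alive S (outer j′) ≡ true →
    BalancedPath (K (5 + m)) σ S (outer j) (outer j′)
  balancedPath-outer-outer {j} {j′} j≢j′ j-alive j′-alive
    with all-alive-choice ∣S∣<2 core (↑ˡ-injective m _ _) arc pentagon-arcs
  ... | a , distinct , arc-alive =
    balancedPathᴷ σ S _ _ (map core (arc a)) (s≤s (s≤s (s≤s (s≤s (s≤s z≤n)))))
      (All.++⁺ (↑ʳ∉map-↑ˡ j (arc a)) ((j≢j′ ∘ ↑ʳ-injective 5 _ _) ∷ [])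
        ∷ AllPairs-map-↑ˡ-∷ʳ j′ distinct)
      (j-alive ∷ All.++⁺ (All.map⁺ arc-alive) (j′-alive ∷ [])) balanced
    where
    balanced : sigSum σ (outer j ∷ map core (arc a) ++ outer j′ ∷ []) ≡ 0ℤ
    balanced rewrite sgn-↑ʳ-↑ˡ m pentagon j a
                   | sgn-↑ˡ m pentagon a (next a) | pentagonSign-next a
                   | sgn-↑ˡ m pentagon (next a) (next (next a)) | pentagonSign-next (next a)
                   | sgn-↑ˡ-↑ʳ m pentagon (next (next a)) j′ = refl

  balancedPath-extendedPentagon : ∀ {u v} → alive S u ≡ true → alive S v ≡ true →
    BalancedPath (K (5 + m)) σ S u v
  balancedPath-extendedPentagon {u} {v} u-alive v-alive with u ≟ v
  ... | yes refl = trivialBalancedPath _ σ S u-alive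
  ... | no u≢v   = by-sides (side u) (side v) u≢v u-alive v-alive
    where
    by-sides : ∀ {u v} → Side {5} {m} u → Side {5} {m} v → u ≢ v →
      alive S u ≡ true → alive S v ≡ true → BalancedPath (K (5 + m)) σ S u v
    by-sides (left i)  (left j)   u≢v = balancedPath-core-core (u≢v ∘ cong core)
    by-sides (left i)  (right j)  _   = balancedPath-core-outer
    by-sides (right j) (left i)   _   = balancedPath-outer-core
    by-sides (right j) (right j′) u≢v = balancedPath-outer-outer (u≢v ∘ cong outer)

lemma2p2 : (n : ℕ) → 5 ≤ n → Canceling (K n) 2
lemma2p2 n 5≤n with m , refl ← m≤n⇒∃[o]m+o≡n 5≤n =
  extendedPentagon m , λ S ∣S∣<2 →
    wiener≡0 _ _ S λ u v u-alive v-alive →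
      dist≡0 (balancedPath-extendedPentagon m ∣S∣<2 u-alive v-alive)
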